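{- Let $m,n \ge 2$ be integers and let $G_{m,n}$ be the $m \times n$ grid graph. Then $f(G_{m,n}) \le 2\lceil \log m \rceil + 2\lceil \log n \rceil$.
   Context: $\log$ is base 2. The $m\times n$ grid $G_{m,n}$ has vertex set $\{0,\dots,m-1\}\times\{0,\dots,n-1\}$, with $(i,j)$ adjacent to $(i',j')$ iff $|i-i'|+|j-j'|=1$. A path in a graph $G$ is a sequence of distinct vertices $v_0,\dots,v_r$ ($r\ge 0$) with consecutive vertices adjacent. A vertex-separating path system of $G$ is a collection of distinct paths in $G$ such that for every pair of distinct vertices $u,v$ some path in the collection contains exactly one of $u$ and $v$. $f(G)$ denotes the minimum size of a vertex-separating path system of $G$. -}

module Defs where

open import Data.Nat using (ℕ; suc; _+_)
open import Data.Fin using (Fin; toℕ)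
open import Data.Product using (_×_; _,_; ∃-syntax)
open import Data.Sum using (_⊎_)
open import Data.List using (List; []; _∷_; length)
open import Data.List.Membership.Propositional using (_∈_; _∉_)
open import Data.List.Relation.Unary.All using (All)
open import Data.List.Relation.Unary.Any using (Any)
open import Data.List.Relation.Unary.Unique.Propositional using (Unique)
open import Relation.Binary.PropositionalEquality using (_≡_)
open import Relation.Nullary using (¬_)

Vertex : ℕ → ℕ → Set
Vertex m n = Fin m × Fin n

Adj : ∀ {m n} → Vertex m n → Vertex m n → Set
Adj (i , j) (i' , j') =
  (i ≡ i' × (suc (toℕ j) ≡ toℕ j' ⊎ suc (toℕ j') ≡ toℕ j))
  ⊎ (j ≡ j' × (suc (toℕ i) ≡ toℕ i' ⊎ suc (toℕ i') ≡ toℕ i))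

data Chain {m n : ℕ} : List (Vertex m n) → Set where
  chain-[] : Chain []
  chain-[x] : ∀ {x} → Chain (x ∷ [])
  chain-∷ : ∀ {x y vs} → Adj x y → Chain (y ∷ vs) → Chain (x ∷ y ∷ vs)

record IsPath {m n : ℕ} (p : List (Vertex m n)) : Set where
  field
    nonempty : ¬ (p ≡ [])
    distinct : Unique p
    adjacent : Chain p

SeparatesBy : ∀ {m n} → List (Vertex m n) → Vertex m n → Vertex m n → Set
SeparatesBy p u v = (u ∈ p × v ∉ p) ⊎ (v ∈ p × u ∉ p)

record IsVSPS {m n : ℕ} (𝒫 : List (List (Vertex m n))) : Set where
  field
    paths : All IsPath 𝒫
    distinctPaths : Unique 𝒫
    separating : ∀ (u v : Vertex m n) → ¬ (u ≡ v) → Any (λ p → SeparatesBy p u v) 𝒫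

module Submission where

-- Row paths are "snakes": a snake crosses some rows of the grid completely and meets every other
-- row in a single cell at one of its two ends, alternating the crossing direction so that
-- consecutive rows join up. For each bit position k < ⌈log₂ m⌉ there are two snakes: P k crosses
-- exactly the rows whose k-th bit is set, Q k exactly the rows whose k-th bit is clear. Two cells
-- in distinct rows x, x' are separated by P k or Q k for a suitable bit k at which x and x' differ,
-- unless they sit at opposite ends of their rows; such a pair is separated by a column snake that
-- contains the whole last column but nothing of the first one. Cells in the same row are separated
-- by the column snakes, which are row snakes of the transposed grid. This gives
-- 2⌈log₂ m⌉ + 2⌈log₂ n⌉ paths, and deleting repetitions keeps the family separating.

open import Defs
open import Data.Bool using (Bool; true; false; not; if_then_else_)
open import Data.Bool.Properties using (not-involutive)
open import Data.Empty using (⊥-elim)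
open import Data.Fin using (Fin; toℕ; fromℕ<)
open import Data.Fin.Properties using (toℕ-injective; toℕ-fromℕ<; toℕ≤pred[n]) renaming (_≟_ to _≟ᶠ_)
open import Data.Maybe using (just)
open import Data.Maybe.Relation.Binary.Connected using (Connected; just; just-nothing)
open import Data.Nat using (ℕ; zero; suc; _≤_; _<_; _+_; _*_; _^_; _∸_; z≤n; s≤s; z<s; s<s; ⌊_/2⌋; ⌈_/2⌉)
open import Data.Nat.Properties
open import Data.Nat.Induction using (<-rec)
open import Data.Nat.Logarithm using (⌈log₂_⌉; ⌈log₂⌈n/2⌉⌉≡⌈log₂n⌉∸1)
open import Data.Product using (_×_; _,_; proj₂; ∃-syntax; swap)
import Data.Product as Product
import Data.Product.Properties as Product
open import Data.Sum using (_⊎_; inj₁; inj₂)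
import Data.Sum as Sum
open import Data.List using (List; []; _∷_; _++_; map; length; head; last; upTo; downFrom; applyDownFrom; _∷ʳ_; deduplicate)
open import Data.List.Properties
  using (upTo-∷ʳ; downFrom-∷ʳ; map-∘; map-id; map-id-local; length-++; length-map; length-deduplicate)
import Data.List.Properties as List
open import Data.List.Membership.Propositional using (_∈_; _∉_; lose; find)
open import Data.List.Membership.Propositional.Properties
  using (∈-map⁺; ∈-map⁻; ∈-++⁺ˡ; ∈-++⁺ʳ; ∈-++⁻; ∈-upTo⁺; ∈-upTo⁻; ∈-downFrom⁺; ∈-downFrom⁻)
open import Data.List.Relation.Unary.All using (All; []; _∷_)
import Data.List.Relation.Unary.All as All
import Data.List.Relation.Unary.All.Properties as All
open import Data.List.Relation.Unary.AllPairs using ([]; _∷_)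
open import Data.List.Relation.Unary.Any using (Any; here; there)
import Data.List.Relation.Unary.Any as Any
import Data.List.Relation.Unary.Any.Properties as Any
open import Data.List.Relation.Unary.Linked using (Linked; []; [-]; _∷_)
import Data.List.Relation.Unary.Linked as Linked
import Data.List.Relation.Unary.Linked.Properties as Linked
open import Data.List.Relation.Unary.Unique.Propositional using (Unique)
import Data.List.Relation.Unary.Unique.Propositional.Properties as Unique
import Data.List.Relation.Unary.Unique.DecPropositional.Properties as DecUnique
open import Function using (_∘_)
open import Relation.Binary.PropositionalEquality
open import Relation.Nullary using (¬_; Dec; yes; no)

-- Binary digits

odd : ℕ → Bool
odd 0 = false
odd 1 = true
odd (suc (suc n)) = odd n

bit : ℕ → ℕ → Bool
bit zero x = odd x
bit (suc k) x = bit k ⌊ x /2⌋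

odd-suc : ∀ x → odd (suc x) ≡ not (odd x)
odd-suc 0 = refl
odd-suc 1 = refl
odd-suc (suc (suc x)) = odd-suc x

parity-step : ∀ x → (odd x ≡ false × ⌊ suc x /2⌋ ≡ ⌊ x /2⌋) ⊎ (odd x ≡ true × ⌊ suc x /2⌋ ≡ suc ⌊ x /2⌋)
parity-step 0 = inj₁ (refl , refl)
parity-step 1 = inj₂ (refl , refl)
parity-step (suc (suc x)) with parity-step x
... | inj₁ (ox , hx) = inj₁ (ox , cong suc hx)
... | inj₂ (ox , hx) = inj₂ (ox , cong suc hx)

bit-zero : ∀ k → bit k 0 ≡ false
bit-zero zero = refl
bit-zero (suc k) = bit-zero k

odd-⌊/2⌋-injective : ∀ {x x'} → odd x ≡ odd x' → ⌊ x /2⌋ ≡ ⌊ x' /2⌋ → x ≡ x'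
odd-⌊/2⌋-injective {0} {0} _ _ = refl
odd-⌊/2⌋-injective {0} {1} () _
odd-⌊/2⌋-injective {0} {suc (suc _)} _ ()
odd-⌊/2⌋-injective {1} {0} () _
odd-⌊/2⌋-injective {1} {1} _ _ = refl
odd-⌊/2⌋-injective {1} {suc (suc _)} _ ()
odd-⌊/2⌋-injective {suc (suc _)} {0} _ ()
odd-⌊/2⌋-injective {suc (suc _)} {1} _ ()
odd-⌊/2⌋-injective {suc (suc x)} {suc (suc x')} o h =
  cong (2 +_) (odd-⌊/2⌋-injective o (suc-injective h))

⌊n/2⌋<m : ∀ {n m} → n < m + m → ⌊ n /2⌋ < m
⌊n/2⌋<m {0} {suc m} _ = z<s
⌊n/2⌋<m {1} {suc m} _ = z<s
⌊n/2⌋<m {suc (suc n)} {suc m} (s<s lt) =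
  s<s (⌊n/2⌋<m (≤-pred (subst (suc (suc n) ≤_) (+-suc m m) lt)))

⌊n/2⌋<2^k : ∀ {n} k → n < 2 ^ suc k → ⌊ n /2⌋ < 2 ^ k
⌊n/2⌋<2^k {n} k lt = ⌊n/2⌋<m (subst (n <_) (cong (2 ^ k +_) (+-identityʳ (2 ^ k))) lt)

-- The end of row x (false: column 0) at which P k keeps its single cell when bit k of x is clear;
-- Q k keeps the other end when bit k is set. For k = 0 every odd row is crossed, so this end
-- alternates with ⌊ x /2⌋.
side : ℕ → ℕ → Bool
side zero x = odd ⌊ x /2⌋
side (suc k) x = false

separating-bit : ∀ K {x x'} → x < 2 ^ K → x' < 2 ^ K → x ≢ x' →
  ∃[ k ] (k < K × bit k x ≢ bit k x' × side k x ≡ side k x')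
separating-bit zero {0} {0} _ _ x≢x' = ⊥-elim (x≢x' refl)
separating-bit zero {suc _} (s≤s ()) _ _
separating-bit zero {_} {suc _} _ (s≤s ()) _
separating-bit (suc K) {x} {x'} x< x'< x≢x' with ⌊ x /2⌋ ≟ ⌊ x' /2⌋
... | yes h≡ = 0 , z<s , (λ o≡ → x≢x' (odd-⌊/2⌋-injective o≡ h≡)) , cong odd h≡
... | no h≢ with separating-bit K (⌊n/2⌋<2^k K x<) (⌊n/2⌋<2^k K x'<) h≢
...   | k , k<K , b≢ , _ = suc k , s<s k<K , b≢ , refl

set-bit : ∀ K {x} → 0 < x → x < 2 ^ K → ∃[ k ] (k < K × bit k x ≡ true)
set-bit K {x} 0<x x< with separating-bit K x< (m^n>0 2 K) (>⇒≢ 0<x)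
... | k , k<K , b≢ , _ with bit k x in eq
...   | true = k , k<K , eq
...   | false = ⊥-elim (b≢ (sym (bit-zero k)))

bit-set⇒positive : ∀ k {x} → bit k x ≡ true → 0 < x
bit-set⇒positive k {0} b with () ← trans (sym (bit-zero k)) b
bit-set⇒positive k {suc x} _ = z<s

n≤2^⌈log₂n⌉ : ∀ n → n ≤ 2 ^ ⌈log₂ n ⌉
n≤2^⌈log₂n⌉ = <-rec _ bound
  where
  bound : ∀ n → (∀ {m} → m < n → m ≤ 2 ^ ⌈log₂ m ⌉) → n ≤ 2 ^ ⌈log₂ n ⌉
  bound 0 _ = z≤n
  bound 1 _ = s≤s z≤n
  bound n@(suc (suc n')) rec = begin
    n                     ≡⟨ sym (⌊n/2⌋+⌈n/2⌉≡n n) ⟩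
    ⌊ n /2⌋ + ⌈ n /2⌉     ≤⟨ +-monoˡ-≤ ⌈ n /2⌉ (⌊n/2⌋≤⌈n/2⌉ n) ⟩
    ⌈ n /2⌉ + ⌈ n /2⌉     ≤⟨ +-mono-≤ half≤ half≤ ⟩
    2 ^ k + 2 ^ k         ≡⟨ cong (2 ^ k +_) (sym (+-identityʳ (2 ^ k))) ⟩ -- ⌈log₂ n⌉ is a successor
    2 ^ ⌈log₂ n ⌉         ∎
    where
    open ≤-Reasoning
    k : ℕ
    k = ⌈log₂ n ⌉ ∸ 1
    half≤ : ⌈ n /2⌉ ≤ 2 ^ k
    half≤ = subst (λ j → ⌈ n /2⌉ ≤ 2 ^ j) (⌈log₂⌈n/2⌉⌉≡⌈log₂n⌉∸1 n) (rec (⌈n/2⌉<n n'))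

-- Paths and separation

Separates : ∀ {A : Set} → List A → A → A → Set
Separates p u v = (u ∈ p × v ∉ p) ⊎ (v ∈ p × u ∉ p)

separates-sym : ∀ {A : Set} {p : List A} {u v} → Separates p u v → Separates p v u
separates-sym (inj₁ s) = inj₂ s
separates-sym (inj₂ s) = inj₁ s

SeparatedIn : ∀ {A : Set} → List (List A) → A → A → Set
SeparatedIn ps u v = Any (λ p → Separates p u v) ps

record IsPathOf {A : Set} (R : A → A → Set) (p : List A) : Set where
  field
    nonempty : p ≢ []
    distinct : Unique p
    linked : Linked R p

module Retract {A B : Set} (g : A → B) (h : B → A) (g∘h : ∀ u → g (h u) ≡ u)
               {xs : List A} (h∘g : map h (map g xs) ≡ xs) where

  ∈-map-retract⁻ : ∀ {u} → u ∈ map g xs → h u ∈ xs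
  ∈-map-retract⁻ m = subst (_ ∈_) h∘g (∈-map⁺ h m)

  ∈-map-retract⁺ : ∀ {u} → h u ∈ xs → u ∈ map g xs
  ∈-map-retract⁺ {u} m = subst (_∈ map g xs) (g∘h u) (∈-map⁺ g m)

  separates-map : ∀ {u v} → Separates xs (h u) (h v) → Separates (map g xs) u v
  separates-map = Sum.map transfer transfer
    where
    transfer : ∀ {u v} → h u ∈ xs × h v ∉ xs → u ∈ map g xs × v ∉ map g xs
    transfer (u∈ , v∉) = ∈-map-retract⁺ u∈ , v∉ ∘ ∈-map-retract⁻

  isPath-map : ∀ {R : A → A → Set} {S : B → B → Set} → (∀ {u v} → R (h u) (h v) → S u v) →
    IsPathOf R xs → IsPathOf S (map g xs)
  isPath-map {R} R⇒S path = record
    { nonempty = λ eq → nonempty (trans (sym h∘g) (cong (map h) eq))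
    ; distinct = Unique.map⁻ (subst Unique (sym h∘g) distinct)
    ; linked = Linked.map R⇒S (Linked.map⁻ (subst (Linked R) (sym h∘g) linked))
    }
    where open IsPathOf path

-- Cells of a grid

Cell : Set
Cell = ℕ × ℕ

infix 4 _∼_
_∼_ : Cell → Cell → Set
(x , y) ∼ (x' , y') =
  (x ≡ x' × (suc y ≡ y' ⊎ suc y' ≡ y)) ⊎ (y ≡ y' × (suc x ≡ x' ⊎ suc x' ≡ x))

column : ℕ → Bool → ℕ
column e false = 0
column e true = e

Opposite : ℕ → ℕ → ℕ → Set
Opposite e y y' = ∃[ s ] (y ≡ column e (not s) × y' ≡ column e s)

opposite-sym : ∀ {e y y'} → Opposite e y y' → Opposite e y' y
opposite-sym {e} (s , y≡ , y'≡) = not s , trans y'≡ (cong (column e) (sym (not-involutive s))) , y≡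

opposite-irrefl : ∀ {e y} → 1 ≤ e → ¬ Opposite e y y
opposite-irrefl 1≤e (false , y≡e , y≡0) = <⇒≢ 1≤e (trans (sym y≡0) y≡e)
opposite-irrefl 1≤e (true , y≡0 , y≡e) = <⇒≢ 1≤e (trans (sym y≡0) y≡e)

InGrid : ℕ → ℕ → Cell → Set
InGrid mr e (x , y) = x ≤ mr × y ≤ e

transpose-retract : ∀ (p : List Cell) → map swap (map swap p) ≡ p
transpose-retract p = trans (sym (map-∘ p)) (map-id p)

transpose-∼ : ∀ {u v : Cell} → swap u ∼ swap v → u ∼ v
transpose-∼ {_ , _} {_ , _} = Sum.swap

-- Snakes

last-map-∷ʳ : ∀ {A B : Set} (f : A → B) xs x → last (map f (xs ∷ʳ x)) ≡ just (f x)
last-map-∷ʳ f [] x = refl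
last-map-∷ʳ f (_ ∷ []) x = refl
last-map-∷ʳ f (_ ∷ y ∷ xs) x = last-map-∷ʳ f (y ∷ xs) x

-- The part of one row, with columns 0 … e, that a snake visits: `across b` is the whole row entered
-- at end b, `endpoint b` the single cell at end b (end false is column 0, end true is column e).
data Segment : Set where
  across : Bool → Segment
  endpoint : Bool → Segment

entry exit : Segment → Bool
entry (across b) = b
entry (endpoint b) = b
exit (across b) = not b
exit (endpoint b) = b

Covers : ℕ → Segment → ℕ → Set
Covers e (across _) y = y ≤ e
Covers e (endpoint b) y = y ≡ column e b

Covers-≤ : ∀ e s {y} → Covers e s y → y ≤ e
Covers-≤ e (across _) y≤e = y≤e
Covers-≤ e (endpoint false) refl = z≤n
Covers-≤ e (endpoint true) refl = ≤-refl

Compatible : (ℕ → Segment) → Set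
Compatible σ = ∀ x → exit (σ x) ≡ entry (σ (suc x))

module Snakes (e : ℕ) where

  segment : ℕ → Segment → List Cell
  segment r (across false) = map (r ,_) (upTo (suc e))
  segment r (across true) = map (r ,_) (downFrom (suc e))
  segment r (endpoint b) = (r , column e b) ∷ []

  ∈-row⁻ : ∀ {r x y : ℕ} {ys} → (x , y) ∈ map (r ,_) ys → x ≡ r × y ∈ ys
  ∈-row⁻ {r} m with ∈-map⁻ (r ,_) m
  ... | _ , y∈ys , refl = refl , y∈ys

  ∈-segment⁻ : ∀ r s {x y} → (x , y) ∈ segment r s → x ≡ r × Covers e s y
  ∈-segment⁻ r (across false) m with ∈-row⁻ m
  ... | x≡r , y∈ = x≡r , ≤-pred (∈-upTo⁻ y∈)
  ∈-segment⁻ r (across true) m with ∈-row⁻ m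
  ... | x≡r , y∈ = x≡r , ≤-pred (∈-downFrom⁻ y∈)
  ∈-segment⁻ r (endpoint b) (here refl) = refl , refl

  ∈-segment⁺ : ∀ r s {y} → Covers e s y → (r , y) ∈ segment r s
  ∈-segment⁺ r (across false) y≤e = ∈-map⁺ _ (∈-upTo⁺ (s≤s y≤e))
  ∈-segment⁺ r (across true) y≤e = ∈-map⁺ _ (∈-downFrom⁺ (s≤s y≤e))
  ∈-segment⁺ r (endpoint b) refl = here refl

  segment-unique : ∀ r s → Unique (segment r s)
  segment-unique r (across false) = Unique.map⁺ (cong proj₂) (Unique.upTo⁺ (suc e))
  segment-unique r (across true) = Unique.map⁺ (cong proj₂) (Unique.downFrom⁺ (suc e))
  segment-unique r (endpoint b) = [] ∷ []

  segment-linked : ∀ r s → Linked _∼_ (segment r s)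
  segment-linked r (across false) =
    Linked.map⁺ (Linked.applyUpTo⁺₂ (λ y → y) (suc e) (λ _ → inj₁ (refl , inj₁ refl)))
  segment-linked r (across true) =
    Linked.map⁺ (Linked.applyDownFrom⁺₂ (λ y → y) (suc e) (λ _ → inj₁ (refl , inj₂ refl)))
  segment-linked r (endpoint b) = [-]

  head-segment : ∀ r s xs → head (segment r s ++ xs) ≡ just (r , column e (entry s))
  head-segment r (across false) xs = refl
  head-segment r (across true) xs = refl
  head-segment r (endpoint b) xs = refl

  last-segment : ∀ r s → last (segment r s) ≡ just (r , column e (exit s))
  last-segment r (across false) =
    subst (λ ys → last (map (r ,_) ys) ≡ just (r , e)) (upTo-∷ʳ e) (last-map-∷ʳ (r ,_) (upTo e) e)
  last-segment r (across true) =
    subst (λ ys → last (map (r ,_) ys) ≡ just (r , 0)) (downFrom-∷ʳ e) (last-map-∷ʳ (r ,_) (applyDownFrom suc e) 0)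
  last-segment r (endpoint b) = refl

  snake : (ℕ → Segment) → ℕ → ℕ → List Cell
  snake σ r zero = []
  snake σ r (suc d) = segment r (σ r) ++ snake σ (suc r) d

  ∈-snake⁻ : ∀ σ r d {x y} → (x , y) ∈ snake σ r d → r ≤ x × x < r + d × Covers e (σ x) y
  ∈-snake⁻ σ r (suc d) m with ∈-++⁻ (segment r (σ r)) m
  ... | inj₁ m' with ∈-segment⁻ r (σ r) m'
  ...   | refl , c = ≤-refl , m<m+n r z<s , c
  ∈-snake⁻ σ r (suc d) {x} m | inj₂ m' with ∈-snake⁻ σ (suc r) d m'
  ...   | r<x , x< , c = <⇒≤ r<x , subst (x <_) (sym (+-suc r d)) x< , c

  ∈-snake⁺ : ∀ σ r d {x y} → r ≤ x → x < r + d → Covers e (σ x) y → (x , y) ∈ snake σ r d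
  ∈-snake⁺ σ r zero {x} r≤x x< _ = ⊥-elim (<⇒≱ x< (subst (_≤ x) (sym (+-identityʳ r)) r≤x))
  ∈-snake⁺ σ r (suc d) {x} r≤x x< c with r ≟ x
  ... | yes refl = ∈-++⁺ˡ (∈-segment⁺ r (σ r) c)
  ... | no r≢x = ∈-++⁺ʳ (segment r (σ r))
    (∈-snake⁺ σ (suc r) d (≤∧≢⇒< r≤x r≢x) (subst (x <_) (+-suc r d) x<) c)

  snake-unique : ∀ σ r d → Unique (snake σ r d)
  snake-unique σ r zero = []
  snake-unique σ r (suc d) =
    Unique.++⁺ (segment-unique r (σ r)) (snake-unique σ (suc r) d) disjoint
    where
    disjoint : ∀ {v} → ¬ (v ∈ segment r (σ r) × v ∈ snake σ (suc r) d)
    disjoint {x , y} (m , m') with ∈-segment⁻ r (σ r) m | ∈-snake⁻ σ (suc r) d m'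
    ... | refl , _ | r<r , _ = <-irrefl refl r<r

  snake-linked : ∀ {σ} → Compatible σ → ∀ r d → Linked _∼_ (snake σ r d)
  snake-linked c r zero = []
  snake-linked {σ} c r (suc d) =
    Linked.++⁺ (segment-linked r (σ r)) (junction d) (snake-linked c (suc r) d)
    where
    junction : ∀ d → Connected _∼_ (last (segment r (σ r))) (head (snake σ (suc r) d))
    junction zero rewrite last-segment r (σ r) = just-nothing
    junction (suc d)
      rewrite last-segment r (σ r) | head-segment (suc r) (σ (suc r)) (snake σ (suc (suc r)) d) | c r
      = just (inj₂ (refl , inj₁ refl))

  snake-nonempty : ∀ σ r d → snake σ r (suc d) ≢ []
  snake-nonempty σ r d eq with () ← trans (sym (head-segment r (σ r) _)) (cong head eq)

  snake-isPath : ∀ σ → Compatible σ → ∀ r d → IsPathOf _∼_ (snake σ r (suc d))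
  snake-isPath σ c r d = record
    { nonempty = snake-nonempty σ r d
    ; distinct = snake-unique σ r (suc d)
    ; linked = snake-linked c r (suc d)
    }

  snake-inGrid : ∀ {mr} σ r d → r + d ≤ suc mr → All (InGrid mr e) (snake σ r d)
  snake-inGrid {mr} σ r d bound = All.tabulate inGrid
    where
    inGrid : ∀ {w} → w ∈ snake σ r d → InGrid mr e w
    inGrid {x , y} m with ∈-snake⁻ σ r d m
    ... | _ , x< , c = ≤-pred (≤-trans x< bound) , Covers-≤ e (σ x) c

-- For k ≥ 1 the rows with bit k set come in runs of even length starting at an even row, so
-- crossing row x from end (odd x) always leaves such a run at column 0.
patternP : ℕ → ℕ → Segment
patternP zero x = (if odd x then across else endpoint) (odd ⌊ x /2⌋)
patternP (suc k) x = if bit (suc k) x then across (odd x) else endpoint false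

patternQ : ℕ → ℕ → Segment
patternQ zero x = if odd x then endpoint (not (odd ⌊ x /2⌋)) else across (odd ⌊ x /2⌋)
patternQ (suc k) x = if bit (suc k) x then endpoint true else across (not (odd x))

compatible-P : ∀ k → Compatible (patternP k)
compatible-P zero x with parity-step x
... | inj₁ (ox , hx) rewrite odd-suc x | ox | hx = refl
... | inj₂ (ox , hx) rewrite odd-suc x | ox | hx | odd-suc ⌊ x /2⌋ = refl
compatible-P (suc k) x with parity-step x
... | inj₁ (ox , hx) rewrite odd-suc x | ox | hx with bit k ⌊ x /2⌋
...   | true = refl
...   | false = refl
compatible-P (suc k) x | inj₂ (ox , hx) rewrite odd-suc x | ox with bit k ⌊ x /2⌋ | bit k ⌊ suc x /2⌋
...   | true | true = refl
...   | true | false = refl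
...   | false | true = refl
...   | false | false = refl

compatible-Q : ∀ k → Compatible (patternQ k)
compatible-Q zero x with parity-step x
... | inj₁ (ox , hx) rewrite odd-suc x | ox | hx = refl
... | inj₂ (ox , hx) rewrite odd-suc x | ox | hx | odd-suc ⌊ x /2⌋ = refl
compatible-Q (suc k) x with parity-step x
... | inj₁ (ox , hx) rewrite odd-suc x | ox | hx with bit k ⌊ x /2⌋
...   | true = refl
...   | false = refl
compatible-Q (suc k) x | inj₂ (ox , hx) rewrite odd-suc x | ox with bit k ⌊ x /2⌋ | bit k ⌊ suc x /2⌋
...   | true | true = refl
...   | true | false = refl
...   | false | true = refl
...   | false | false = refl

module RowFamily (mr e : ℕ) where
  open Snakes e

  -- Row 0 is left out of P k, which is what lets it separate the last row from row 0.
  P Q : ℕ → List Cell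
  P k = snake (patternP k) 1 mr
  Q k = snake (patternQ k) 0 (suc mr)

  covers-P⁺ : ∀ k {x y} → bit k x ≡ true → y ≤ e → Covers e (patternP k x) y
  covers-P⁺ zero b y≤e rewrite b = y≤e
  covers-P⁺ (suc k) b y≤e rewrite b = y≤e

  covers-P⁻ : ∀ k {x y} → bit k x ≡ false → Covers e (patternP k x) y → y ≡ column e (side k x)
  covers-P⁻ zero b c rewrite b = c
  covers-P⁻ (suc k) b c rewrite b = c

  covers-Q⁺ : ∀ k {x y} → bit k x ≡ false → y ≤ e → Covers e (patternQ k x) y
  covers-Q⁺ zero b y≤e rewrite b = y≤e
  covers-Q⁺ (suc k) b y≤e rewrite b = y≤e

  covers-Q⁻ : ∀ k {x y} → bit k x ≡ true → Covers e (patternQ k x) y → y ≡ column e (not (side k x))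
  covers-Q⁻ zero b c rewrite b = c
  covers-Q⁻ (suc k) b c rewrite b = c

  ∈-P⁺ : ∀ k {x y} → bit k x ≡ true → x ≤ mr → y ≤ e → (x , y) ∈ P k
  ∈-P⁺ k b x≤mr y≤e = ∈-snake⁺ (patternP k) 1 mr (bit-set⇒positive k b) (s≤s x≤mr) (covers-P⁺ k b y≤e)

  ∈-Q⁺ : ∀ k {x y} → bit k x ≡ false → x ≤ mr → y ≤ e → (x , y) ∈ Q k
  ∈-Q⁺ k b x≤mr y≤e = ∈-snake⁺ (patternQ k) 0 (suc mr) z≤n (s≤s x≤mr) (covers-Q⁺ k b y≤e)

  ∈-P⁻ : ∀ k {x y} → bit k x ≡ false → (x , y) ∈ P k → y ≡ column e (side k x)
  ∈-P⁻ k b m = covers-P⁻ k b (proj₂ (proj₂ (∈-snake⁻ (patternP k) 1 mr m)))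

  ∈-Q⁻ : ∀ k {x y} → bit k x ≡ true → (x , y) ∈ Q k → y ≡ column e (not (side k x))
  ∈-Q⁻ k b m = covers-Q⁻ k b (proj₂ (proj₂ (∈-snake⁻ (patternQ k) 0 (suc mr) m)))

  row-0∉P : ∀ k {y} → (0 , y) ∉ P k
  row-0∉P k m with ∈-snake⁻ (patternP k) 1 mr m
  ... | () , _

  rowFamily : ℕ → List (List Cell)
  rowFamily zero = []
  rowFamily (suc K) = P K ∷ Q K ∷ rowFamily K

  length-rowFamily : ∀ K → length (rowFamily K) ≡ 2 * K
  length-rowFamily zero = refl
  length-rowFamily (suc K) = cong suc (trans (cong suc (length-rowFamily K)) (sym (+-suc K (K + 0))))

  rowFamily-paths : 1 ≤ mr → ∀ K → All (λ p → IsPathOf _∼_ p × All (InGrid mr e) p) (rowFamily K)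
  rowFamily-paths 1≤mr zero = []
  rowFamily-paths 1≤mr@(s≤s {n = mr-1} _) (suc K) =
    (snake-isPath (patternP K) (compatible-P K) 1 mr-1 , snake-inGrid (patternP K) 1 mr ≤-refl) ∷
    (snake-isPath (patternQ K) (compatible-Q K) 0 mr , snake-inGrid (patternQ K) 0 (suc mr) ≤-refl) ∷
    rowFamily-paths 1≤mr K

  P∈rowFamily : ∀ {k K} → k < K → P k ∈ rowFamily K
  P∈rowFamily {K = suc K} k<1+K with m<1+n⇒m<n∨m≡n k<1+K
  ... | inj₁ k<K = there (there (P∈rowFamily k<K))
  ... | inj₂ refl = here refl

  Q∈rowFamily : ∀ {k K} → k < K → Q k ∈ rowFamily K
  Q∈rowFamily {K = suc K} k<1+K with m<1+n⇒m<n∨m≡n k<1+K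
  ... | inj₁ k<K = there (there (Q∈rowFamily k<K))
  ... | inj₂ refl = there (here refl)

  separated-unless-opposite : ∀ {A B : List Cell} s {x y x' y'} →
    (x , y) ∈ A → (x' , y') ∈ B →
    ((x' , y') ∈ A → y' ≡ column e s) → ((x , y) ∈ B → y ≡ column e (not s)) →
    Separates A (x , y) (x' , y') ⊎ Separates B (x , y) (x' , y') ⊎ Opposite e y y'
  separated-unless-opposite s {y = y} {y' = y'} u∈A v∈B A-side B-side
    with y' ≟ column e s | y ≟ column e (not s)
  ... | no y'≢ | _ = inj₁ (inj₁ (u∈A , λ v∈A → y'≢ (A-side v∈A)))
  ... | yes _ | no y≢ = inj₂ (inj₁ (inj₂ (v∈B , λ u∈B → y≢ (B-side u∈B))))
  ... | yes y'≡ | yes y≡ = inj₂ (inj₂ (s , y≡ , y'≡))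

  rows-separated-at : ∀ {K k x y x' y'} → k < K → bit k x ≡ true → bit k x' ≡ false →
    side k x ≡ side k x' → x ≤ mr → x' ≤ mr → y ≤ e → y' ≤ e →
    SeparatedIn (rowFamily K) (x , y) (x' , y') ⊎ Opposite e y y'
  rows-separated-at {k = k} {x' = x'} k<K bx bx' side≡ x≤ x'≤ y≤ y'≤
    with separated-unless-opposite (side k x') (∈-P⁺ k bx x≤ y≤) (∈-Q⁺ k bx' x'≤ y'≤) (∈-P⁻ k bx')
           (λ m → trans (∈-Q⁻ k bx m) (cong (column e ∘ not) side≡))
  ... | inj₁ sep = inj₁ (lose (P∈rowFamily k<K) sep)
  ... | inj₂ (inj₁ sep) = inj₁ (lose (Q∈rowFamily k<K) sep)
  ... | inj₂ (inj₂ opp) = inj₂ opp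

  rows-separated : ∀ K {x y x' y'} → suc mr ≤ 2 ^ K → x ≤ mr → x' ≤ mr → y ≤ e → y' ≤ e → x ≢ x' →
    SeparatedIn (rowFamily K) (x , y) (x' , y') ⊎ Opposite e y y'
  rows-separated K {x} {y} {x'} {y'} bound x≤ x'≤ y≤ y'≤ x≢x'
    with separating-bit K (≤-trans (s≤s x≤) bound) (≤-trans (s≤s x'≤) bound) x≢x'
  ... | k , k<K , bit≢ , side≡ with bit k x in bx | bit k x' in bx'
  ...   | true | true = ⊥-elim (bit≢ refl)
  ...   | false | false = ⊥-elim (bit≢ refl)
  ...   | true | false = rows-separated-at k<K bx bx' side≡ x≤ x'≤ y≤ y'≤
  ...   | false | true =
    Sum.map (Any.map separates-sym) opposite-sym
      (rows-separated-at k<K bx' bx (sym side≡) x'≤ x≤ y'≤ y≤)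

  extreme-rows-separated : ∀ k {y y'} → bit k mr ≡ true → y ≤ e → Separates (P k) (mr , y) (0 , y')
  extreme-rows-separated k b y≤ = inj₁ (∈-P⁺ k b ≤-refl y≤ , row-0∉P k)

-- Vertices of the grid

clamp : ∀ n → ℕ → Fin (suc n)
clamp n x = fromℕ< (s≤s (m⊓n≤n x n))

toℕ-clamp : ∀ {n x} → x ≤ n → toℕ (clamp n x) ≡ x
toℕ-clamp {n} {x} x≤n = trans (toℕ-fromℕ< (s≤s (m⊓n≤n x n))) (m≤n⇒m⊓n≡m x≤n)

module GridVertices (mr nc : ℕ) where

  vertex : Cell → Vertex (suc mr) (suc nc)
  vertex (x , y) = clamp mr x , clamp nc y

  cell : Vertex (suc mr) (suc nc) → Cell
  cell (i , j) = toℕ i , toℕ j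

  cell-inGrid : ∀ u → InGrid mr nc (cell u)
  cell-inGrid (i , j) = toℕ≤pred[n] i , toℕ≤pred[n] j

  cell-vertex : ∀ {w} → InGrid mr nc w → cell (vertex w) ≡ w
  cell-vertex (x≤ , y≤) = cong₂ _,_ (toℕ-clamp x≤) (toℕ-clamp y≤)

  vertex-cell : ∀ u → vertex (cell u) ≡ u
  vertex-cell (i , j) =
    cong₂ _,_ (toℕ-injective (toℕ-clamp (toℕ≤pred[n] i))) (toℕ-injective (toℕ-clamp (toℕ≤pred[n] j)))

  ∼⇒Adj : ∀ {u v} → cell u ∼ cell v → Adj u v
  ∼⇒Adj {_ , _} {_ , _} = Sum.map (Product.map₁ toℕ-injective) (Product.map₁ toℕ-injective)

  linked⇒chain : ∀ {p : List (Vertex (suc mr) (suc nc))} → Linked Adj p → Chain p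
  linked⇒chain [] = chain-[]
  linked⇒chain [-] = chain-[x]
  linked⇒chain (a ∷ l) = chain-∷ a (linked⇒chain l)

  module OnGrid {p : List Cell} (inGrid : All (InGrid mr nc) p) =
    Retract vertex cell vertex-cell (trans (sym (map-∘ p)) (map-id-local (All.map cell-vertex inGrid)))

  vertexPath : ∀ {p} → IsPathOf _∼_ p × All (InGrid mr nc) p → IsPath (map vertex p)
  vertexPath (path , inGrid) = record
    { nonempty = nonempty
    ; distinct = distinct
    ; adjacent = linked⇒chain linked
    }
    where open IsPathOf (OnGrid.isPath-map inGrid ∼⇒Adj path)

  cell-injective : ∀ {u v} → cell u ≡ cell v → u ≡ v
  cell-injective {u} {v} eq = trans (sym (vertex-cell u)) (trans (cong vertex eq) (vertex-cell v))

  _≟ᵖ_ : (p q : List (Vertex (suc mr) (suc nc))) → Dec (p ≡ q)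
  _≟ᵖ_ = List.≡-dec (Product.≡-dec _≟ᶠ_ _≟ᶠ_)

  vsps-from-cell-paths : ∀ (ps : List (List Cell)) →
    All (λ p → IsPathOf _∼_ p × All (InGrid mr nc) p) ps →
    (∀ {u v} → InGrid mr nc u → InGrid mr nc v → u ≢ v → SeparatedIn ps u v) →
    ∃[ 𝒫 ] (IsVSPS 𝒫 × length 𝒫 ≤ length ps)
  vsps-from-cell-paths ps paths separates = deduplicate _≟ᵖ_ vps , isVSPS , size
    where
    vps : List (List (Vertex (suc mr) (suc nc)))
    vps = map (map vertex) ps

    vps-separates : ∀ u v → u ≢ v → SeparatedIn vps u v
    vps-separates u v u≢v with find (separates (cell-inGrid u) (cell-inGrid v) (u≢v ∘ cell-injective))
    ... | p , p∈ , sep =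
      lose (∈-map⁺ (map vertex) p∈) (OnGrid.separates-map (proj₂ (All.lookup paths p∈)) sep)

    isVSPS : IsVSPS (deduplicate _≟ᵖ_ vps)
    isVSPS = record
      { paths = All.deduplicate⁺ _≟ᵖ_ (All.map⁺ (All.map vertexPath paths))
      ; distinctPaths = DecUnique.deduplicate-! _≟ᵖ_ vps
      ; separating = λ u v u≢v → Any.deduplicate⁺ _≟ᵖ_ (λ { refl sep → sep }) (vps-separates u v u≢v)
      }

    size : length (deduplicate _≟ᵖ_ vps) ≤ length ps
    size = ≤-trans (length-deduplicate _≟ᵖ_ vps) (≤-reflexive (length-map (map vertex) ps))

module SnakeFamily (mr nc : ℕ) (1≤mr : 1 ≤ mr) (1≤nc : 1 ≤ nc) where

  K L : ℕ
  K = ⌈log₂ suc mr ⌉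
  L = ⌈log₂ suc nc ⌉

  module Rows = RowFamily mr nc
  module Columns = RowFamily nc mr

  family : List (List Cell)
  family = Rows.rowFamily K ++ map (map swap) (Columns.rowFamily L)

  length-family : length family ≡ 2 * K + 2 * L
  length-family = begin
    length family
      ≡⟨ length-++ (Rows.rowFamily K) ⟩
    length (Rows.rowFamily K) + length (map (map swap) (Columns.rowFamily L))
      ≡⟨ cong (length (Rows.rowFamily K) +_) (length-map (map swap) (Columns.rowFamily L)) ⟩
    length (Rows.rowFamily K) + length (Columns.rowFamily L)
      ≡⟨ cong₂ _+_ (Rows.length-rowFamily K) (Columns.length-rowFamily L) ⟩
    2 * K + 2 * L ∎
    where open ≡-Reasoning

  module Transposed (p : List Cell) = Retract swap swap (λ _ → refl) (transpose-retract p)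

  family-paths : All (λ p → IsPathOf _∼_ p × All (InGrid mr nc) p) family
  family-paths = All.++⁺ (Rows.rowFamily-paths 1≤mr K)
    (All.map⁺ (All.map transposed (Columns.rowFamily-paths 1≤nc L)))
    where
    transposed : ∀ {p} → IsPathOf _∼_ p × All (InGrid nc mr) p →
      IsPathOf _∼_ (map swap p) × All (InGrid mr nc) (map swap p)
    transposed {p} (path , inGrid) =
      Transposed.isPath-map p transpose-∼ path , All.map⁺ (All.map Product.swap inGrid)

  opposite-separated : ∀ {x y x' y'} → x ≤ mr → x' ≤ mr → Opposite nc y y' →
    SeparatedIn (map (map swap) (Columns.rowFamily L)) (x , y) (x' , y')
  opposite-separated {x} {y} {x'} {y'} x≤ x'≤ opp with set-bit L 1≤nc (n≤2^⌈log₂n⌉ (suc nc))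
  ... | ℓ , ℓ<L , bℓ =
    Any.map⁺ (lose (Columns.P∈rowFamily ℓ<L) (Transposed.separates-map (Columns.P ℓ) (separated opp)))
    where
    separated : Opposite nc y y' → Separates (Columns.P ℓ) (y , x) (y' , x')
    separated (false , refl , refl) = Columns.extreme-rows-separated ℓ bℓ x≤
    separated (true , refl , refl) = separates-sym (Columns.extreme-rows-separated ℓ bℓ x'≤)

  family-separates : ∀ {u v} → InGrid mr nc u → InGrid mr nc v → u ≢ v → SeparatedIn family u v
  family-separates {x , y} {x' , y'} (x≤ , y≤) (x'≤ , y'≤) u≢v with x ≟ x'
  ... | no x≢x' with Rows.rows-separated K (n≤2^⌈log₂n⌉ (suc mr)) x≤ x'≤ y≤ y'≤ x≢x'
  ...   | inj₁ sep = Any.++⁺ˡ sep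
  ...   | inj₂ opp = Any.++⁺ʳ (Rows.rowFamily K) (opposite-separated x≤ x'≤ opp)
  family-separates {x , y} {x' , y'} (x≤ , y≤) (x'≤ , y'≤) u≢v | yes refl
    with Columns.rows-separated L (n≤2^⌈log₂n⌉ (suc nc)) y≤ y'≤ x≤ x'≤ (u≢v ∘ cong (x ,_))
  ...   | inj₁ sep = Any.++⁺ʳ (Rows.rowFamily K) (Any.map⁺ (Any.map (Transposed.separates-map _) sep))
  ...   | inj₂ opp = ⊥-elim (opposite-irrefl 1≤mr opp)

theorem11 : ∀ (m n : ℕ) → 2 ≤ m → 2 ≤ n →
    ∃[ 𝒫 ] (IsVSPS {m} {n} 𝒫 × length 𝒫 ≤ 2 * ⌈log₂ m ⌉ + 2 * ⌈log₂ n ⌉)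
theorem11 (suc mr) (suc nc) (s≤s 1≤mr) (s≤s 1≤nc) =
  let 𝒫 , isVSPS , 𝒫≤ = vsps-from-cell-paths family family-paths family-separates
  in 𝒫 , isVSPS , ≤-trans 𝒫≤ (≤-reflexive length-family)
  where
  open SnakeFamily mr nc 1≤mr 1≤nc
  open GridVertices mr nc
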